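{- Let QHC+H be QHC extended by the H-principle $\cdot\,?(\gamma\lor\neg\gamma)$, and write $\nabla\Phi:=\,!?\Phi$. In QHC+H the following equivalences hold, where "equivalent" means each side is derivable in QHC+H from the other. (a) The PC-principle $\cdot\,\nabla\alpha\to\alpha$ is equivalent to the PC-rule $\nabla\alpha/\alpha$, and also to $\cdot\,\alpha\lor\neg\alpha$. (b) The D-principle $\cdot\,\nabla(\alpha\lor\beta)\to(\nabla\alpha\lor\nabla\beta)$ is equivalent to Jankov's principle $\cdot\,\neg\alpha\lor\neg\neg\alpha$. (c) The $\forall_\nabla$-principle $\cdot\,\nabla\forall x\,\alpha(x)\leftrightarrow\forall x\,\nabla\alpha(x)$ is equivalent to the Double Negation Shift principle $\cdot\,\forall x\,\neg\neg\alpha(x)\to\neg\neg\forall x\,\alpha(x)$. (d) The $\exists_\nabla$-principle $\cdot\,\exists x\,\nabla\alpha(x)\leftrightarrow\nabla\exists x\,\alpha(x)$ is equivalent to the Strong Markov principle $\cdot\,\neg\neg\exists x\,\alpha(x)\to\exists x\,\neg\neg\alpha(x)$. (e) The ED-principle $\cdot\,\neg(\alpha\land\beta)\to\big(\nabla(\alpha\lor\beta)\to\nabla\alpha\lor\nabla\beta\big)$ is equivalent to $\cdot\,\nabla\alpha\lor\neg\nabla\alpha$.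
   Context: Meta-logical framework. Formulas of a first-order language may contain individual variables and predicate variables. Meta-formulas are built from formulas using meta-conjunction $\&$, meta-implication $\Rightarrow$, and universal meta-quantifiers over individual and predicate variables. A principle $\cdot G$, for a formula $G$, is the meta-formula obtained by universally meta-quantifying all free individual variables of $G$ and then all predicate variables of $G$. A rule $F_1,\dots,F_m/G$ is the meta-formula $\forall^2(\forall^1F_1\,\&\cdots\&\,\forall^1F_m\Rightarrow\forall^1G)$, where $\forall^1$ meta-quantifies the free individual variables of the formula it precedes and $\forall^2$ meta-quantifies all predicate variables occurring. A logic $L$ is given by a derivation system $\mathcal D$, a meta-conjunction of finitely many principles and rules; extending $L$ by a principle means adding it to $\mathcal D$. For a meta-formula $\mathcal F$, $\vdash_L\mathcal F$ means that $\mathcal D\Rightarrow\mathcal F$ is derivable by the natural-deduction meta-rules: introduction and elimination of $\&$, $\Rightarrow$ and the universal meta-quantifiers (elimination allows substituting terms for individual variables and formulas for predicate variables), plus $\alpha$-conversion. The notation $\mathcal F\vdash_L\mathcal G$ means $\vdash_L\mathcal F\Rightarrow\mathcal G$. Language of QHC. It has individual variables and, for each $n\ge0$, countably many $n$-ary problem variables $\alpha,\beta,\gamma,\delta,\theta,\dots$ and countably many $n$-ary proper predicate variables $p,q,\dots$. - A c-formula is $\top$, $\bot$, an atom $p(x_1,\dots,x_n)$, or $?\Phi$ for an i-formula $\Phi$, closed under the classical connectives $\land,\lor,\to,\leftrightarrow,\neg$ and quantifiers $\exists,\forall$. - An i-formula is $\checkmark$ (triviality), $\curlywedge$ (absurdity),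 an atom $\alpha(x_1,\dots,x_n)$, or $!F$ for a c-formula $F$, closed under the intuitionistic connectives $\land,\lor,\to,\leftrightarrow,\neg$ (with $\neg\Phi:=\Phi\to\curlywedge$) and quantifiers $\exists,\forall$. Connectives applied to c-formulas are classical; those applied to i-formulas are intuitionistic. QHC is the logic whose derivation system consists of: - (0a) all laws and rules of classical predicate logic QC, for c-formulas; - (0b) all laws and rules of intuitionistic predicate logic QH, for i-formulas; - the principles $\cdot\,?(\gamma\land\delta)\leftrightarrow ?\gamma\land ?\delta$, $\cdot\,?(\gamma\lor\delta)\leftrightarrow ?\gamma\lor ?\delta$, $\cdot\,?(\gamma\to\delta)\to(?\gamma\to ?\delta)$, $\cdot\,\neg ?\curlywedge$, $\cdot\,?\exists x\,\theta(x)\leftrightarrow\exists x\,?\theta(x)$, $\cdot\,?\forall x\,\theta(x)\to\forall x\,?\theta(x)$, $\cdot\,\gamma\to\,!?\gamma$, $\cdot\,\neg !\bot$, $\cdot\,?!p\to p$, $\cdot\,!p\to\,!?!p$ and $\cdot\,!(p\to q)\to(!p\to !q)$; - the rules $!p/p$ and $p/!p$. -}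

module Defs where

open import Data.Nat using (ℕ; zero; suc)
open import Data.Vec using (Vec; map)
open import Data.Sum using (_⊎_)
open import Data.Product using (_×_)
open import Data.Empty using (⊥)
open import Level using (Level; 0ℓ) renaming (suc to lsuc)

-- Two sorts: c (classical formulas, c-formulas) and i (intuitionistic
-- formulas, i-formulas).  Individual variables are de Bruijn indices
-- (the language has no function symbols, so terms are variables).

data Sort : Set where
  c i : Sort

infixr 6 _∧'_
infixr 5 _∨'_
infixr 4 _⇒_ _⇔_
infix  8 ⁇_ !_ ∇_ ~_

data Fm : Sort → Set where
  -- atoms: the k-th n-ary predicate variable of the sort
  -- (sort i: problem variables α, β, …; sort c: proper predicate variables p, q, …)
  pv   : ∀ {s} (n k : ℕ) → Vec ℕ n → Fm s
  ⊤'   : ∀ {s} → Fm s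
  ⊥'   : ∀ {s} → Fm s
  _∧'_ : ∀ {s} → Fm s → Fm s → Fm s
  _∨'_ : ∀ {s} → Fm s → Fm s → Fm s
  _⇒_  : ∀ {s} → Fm s → Fm s → Fm s
  ∀'   : ∀ {s} → Fm s → Fm s
  ∃'   : ∀ {s} → Fm s → Fm s
  ⁇_   : Fm i → Fm c
  !_   : Fm c → Fm i

~_ : ∀ {s} → Fm s → Fm s
~ A = A ⇒ ⊥'

_⇔_ : ∀ {s} → Fm s → Fm s → Fm s
A ⇔ B = (A ⇒ B) ∧' (B ⇒ A)

∇_ : Fm i → Fm i
∇ A = ! (⁇ A)

-- Renaming of individual variables (= substitution of terms, since
-- terms are variables).

lift : (ℕ → ℕ) → ℕ → ℕ
lift ρ zero    = zero
lift ρ (suc n) = suc (ρ n)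

ren : ∀ {s} → (ℕ → ℕ) → Fm s → Fm s
ren ρ (pv n k xs) = pv n k (map ρ xs)
ren ρ ⊤'       = ⊤'
ren ρ ⊥'       = ⊥'
ren ρ (A ∧' B) = ren ρ A ∧' ren ρ B
ren ρ (A ∨' B) = ren ρ A ∨' ren ρ B
ren ρ (A ⇒ B)  = ren ρ A ⇒ ren ρ B
ren ρ (∀' A)   = ∀' (ren (lift ρ) A)
ren ρ (∃' A)   = ∃' (ren (lift ρ) A)
ren ρ (⁇ A)    = ⁇ ren ρ A
ren ρ (! A)    = ! ren ρ A

wk : ∀ {s} → Fm s → Fm s
wk = ren suc

inst : ℕ → ℕ → ℕ
inst t zero    = t
inst t (suc n) = n

_[_] : ∀ {s} → Fm s → ℕ → Fm s
A [ t ] = ren (inst t) A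

data Axiom : ∀ {s} → Fm s → Set where
  k      : ∀ {s} (A B : Fm s) → Axiom (A ⇒ B ⇒ A)
  sk     : ∀ {s} (A B C : Fm s) → Axiom ((A ⇒ B ⇒ C) ⇒ (A ⇒ B) ⇒ A ⇒ C)
  ∧e₁    : ∀ {s} (A B : Fm s) → Axiom (A ∧' B ⇒ A)
  ∧e₂    : ∀ {s} (A B : Fm s) → Axiom (A ∧' B ⇒ B)
  ∧i     : ∀ {s} (A B : Fm s) → Axiom (A ⇒ B ⇒ A ∧' B)
  ∨i₁    : ∀ {s} (A B : Fm s) → Axiom (A ⇒ A ∨' B)
  ∨i₂    : ∀ {s} (A B : Fm s) → Axiom (B ⇒ A ∨' B)
  ∨e     : ∀ {s} (A B C : Fm s) → Axiom ((A ⇒ C) ⇒ (B ⇒ C) ⇒ A ∨' B ⇒ C)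
  ⊥e     : ∀ {s} (A : Fm s) → Axiom (⊥' ⇒ A)
  ⊤i     : ∀ {s} → Axiom (⊤' {s})
  ∀e     : ∀ {s} (A : Fm s) (t : ℕ) → Axiom (∀' A ⇒ A [ t ])
  ∃i     : ∀ {s} (A : Fm s) (t : ℕ) → Axiom (A [ t ] ⇒ ∃' A)
  dne    : (A : Fm c) → Axiom (~ ~ A ⇒ A)
  ?∧     : (γ δ : Fm i) → Axiom (⁇ (γ ∧' δ) ⇔ ⁇ γ ∧' ⁇ δ)
  ?∨     : (γ δ : Fm i) → Axiom (⁇ (γ ∨' δ) ⇔ ⁇ γ ∨' ⁇ δ)
  ?⇒     : (γ δ : Fm i) → Axiom (⁇ (γ ⇒ δ) ⇒ ⁇ γ ⇒ ⁇ δ)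
  ¬?⊥    : Axiom (~ (⁇ ⊥'))
  ?∃     : (θ : Fm i) → Axiom (⁇ (∃' θ) ⇔ ∃' (⁇ θ))
  ?∀     : (θ : Fm i) → Axiom (⁇ (∀' θ) ⇒ ∀' (⁇ θ))
  γ!?    : (γ : Fm i) → Axiom (γ ⇒ ! ⁇ γ)
  ¬!⊥    : Axiom (~ (! ⊥'))
  ?!p    : (p : Fm c) → Axiom (⁇ ! p ⇒ p)
  !p!?!p : (p : Fm c) → Axiom (! p ⇒ ! ⁇ ! p)
  !⇒     : (p q : Fm c) → Axiom (! (p ⇒ q) ⇒ ! p ⇒ ! q)

-- a set of (instances of) principles, and a set of (instances of)
-- one-premise rules, used to extend QHC; hypotheses are treated like
-- extra axioms that are not closed under substitution of predicate
-- variables (free individual variables are implicitly generalised).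
Principles : Set₁
Principles = ∀ {s} → Fm s → Set

Rules : Set₁
Rules = ∀ {s t} → Fm s → Fm t → Set

data Der (Ax : Principles) (Rl : Rules) (Hy : Principles) : ∀ {s} → Fm s → Set where
  hyp   : ∀ {s} {A : Fm s} → Hy A → Der Ax Rl Hy A
  ext   : ∀ {s} {A : Fm s} → Ax A → Der Ax Rl Hy A
  extR  : ∀ {s t} {A : Fm s} {B : Fm t} → Rl A B → Der Ax Rl Hy A → Der Ax Rl Hy B
  ax    : ∀ {s} {A : Fm s} → Axiom A → Der Ax Rl Hy A
  mp    : ∀ {s} {A B : Fm s} → Der Ax Rl Hy (A ⇒ B) → Der Ax Rl Hy A → Der Ax Rl Hy B
  -- B → A(x) / B → ∀x A(x)   (x not free in B)
  gen∀  : ∀ {s} {A B : Fm s} → Der Ax Rl Hy (wk B ⇒ A) → Der Ax Rl Hy (B ⇒ ∀' A)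
  -- A(x) → B / ∃x A(x) → B   (x not free in B)
  gen∃  : ∀ {s} {A B : Fm s} → Der Ax Rl Hy (A ⇒ wk B) → Der Ax Rl Hy (∃' A ⇒ B)
  unbang : {p : Fm c} → Der Ax Rl Hy (! p) → Der Ax Rl Hy p
  bang   : {p : Fm c} → Der Ax Rl Hy p → Der Ax Rl Hy (! p)

NoRules : Rules
NoRules _ _ = ⊥

NoHyps : Principles
NoHyps _ = ⊥

_∪_ : Principles → Principles → Principles
(P ∪ Q) F = P F ⊎ Q F

data Single {s} (A : Fm s) : Principles where
  here : Single A A

data H : Principles where
  h : (γ : Fm i) → H (⁇ (γ ∨' ~ γ))

data PC : Principles where
  pc : (α : Fm i) → PC (∇ α ⇒ α)

data PCRule : Rules where
  pcr : (α : Fm i) → PCRule (∇ α) α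

data LEM : Principles where
  lem : (α : Fm i) → LEM (α ∨' ~ α)

data D : Principles where
  d : (α β : Fm i) → D (∇ (α ∨' β) ⇒ ∇ α ∨' ∇ β)

data Jankov : Principles where
  jan : (α : Fm i) → Jankov (~ α ∨' ~ ~ α)

data ∀∇ : Principles where
  a∇ : (α : Fm i) → ∀∇ (∇ (∀' α) ⇔ ∀' (∇ α))

data DNS : Principles where
  dns : (α : Fm i) → DNS (∀' (~ ~ α) ⇒ ~ ~ ∀' α)

data ∃∇ : Principles where
  e∇ : (α : Fm i) → ∃∇ (∃' (∇ α) ⇔ ∇ (∃' α))

data SMP : Principles where
  smp : (α : Fm i) → SMP (~ ~ ∃' α ⇒ ∃' (~ ~ α))

data ED : Principles where
  ed : (α β : Fm i) → ED (~ (α ∧' β) ⇒ ∇ (α ∨' β) ⇒ ∇ α ∨' ∇ β)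

data WLEM∇ : Principles where
  wl : (α : Fm i) → WLEM∇ (∇ α ∨' ~ ∇ α)

_⊩_ : Principles → Principles → Set
P ⊩ Q = ∀ {s} {F : Fm s} → Q F → Der (H ∪ P) NoRules NoHyps F

_≣_ : Principles → Principles → Set
P ≣ Q = (P ⊩ Q) × (Q ⊩ P)

-- the PC-principle yields the PC-rule: from the hypothesis ∀¹∇α derive ∀¹α
PC⊩PCRule : Set
PC⊩PCRule = (α : Fm i) → Der (H ∪ PC) NoRules (Single (∇ α)) α

PCRule⊩PC : Set
PCRule⊩PC = ∀ {s} {F : Fm s} → PC F → Der H PCRule NoHyps F

-- One always has ∇α → ¬¬α (from γ → !?γ and the
-- ¬?⋏, ¬!⊥ axioms), and the H-principle ?(γ ∨ ¬γ) supplies the converse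
-- ¬¬α → ∇α.  So in QHC+H the modality ∇ is double negation, and each
-- principle becomes its purely intuitionistic counterpart: PC is ¬¬α → α
-- (i.e. excluded middle), D is ¬¬(α ∨ β) → ¬¬α ∨ ¬¬β (i.e. Jankov), the
-- ∀∇/∃∇ commutations are the double negation shift and strong Markov, and
-- ED collapses to D because ∇α ∨ ¬∇α makes one disjunct decidable.
module Submission where

open import Defs
open import Data.Product using (_×_; _,_)
open import Data.Sum using (inj₁; inj₂)
open import Data.Nat using (ℕ; zero; suc)
open import Data.Vec.Properties using (map-∘; map-cong; map-id)
open import Relation.Binary.PropositionalEquality
  using (_≡_; refl; sym; trans; cong; cong₂; subst)

lift-cancel : (ρ σ : ℕ → ℕ) → (∀ m → ρ (σ m) ≡ m) → ∀ m → lift ρ (lift σ m) ≡ m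
lift-cancel ρ σ ρσ zero    = refl
lift-cancel ρ σ ρσ (suc m) = cong suc (ρσ m)

ren-cancel : ∀ {s} (ρ σ : ℕ → ℕ) → (∀ m → ρ (σ m) ≡ m) → (A : Fm s) → ren ρ (ren σ A) ≡ A
ren-cancel ρ σ ρσ (pv n j xs) =
  cong (pv n j) (trans (sym (map-∘ ρ σ xs)) (trans (map-cong ρσ xs) (map-id xs)))
ren-cancel ρ σ ρσ ⊤'       = refl
ren-cancel ρ σ ρσ ⊥'       = refl
ren-cancel ρ σ ρσ (A ∧' B) = cong₂ _∧'_ (ren-cancel ρ σ ρσ A) (ren-cancel ρ σ ρσ B)
ren-cancel ρ σ ρσ (A ∨' B) = cong₂ _∨'_ (ren-cancel ρ σ ρσ A) (ren-cancel ρ σ ρσ B)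
ren-cancel ρ σ ρσ (A ⇒ B)  = cong₂ _⇒_ (ren-cancel ρ σ ρσ A) (ren-cancel ρ σ ρσ B)
ren-cancel ρ σ ρσ (∀' A)   = cong ∀' (ren-cancel (lift ρ) (lift σ) (lift-cancel ρ σ ρσ) A)
ren-cancel ρ σ ρσ (∃' A)   = cong ∃' (ren-cancel (lift ρ) (lift σ) (lift-cancel ρ σ ρσ) A)
ren-cancel ρ σ ρσ (⁇ A)    = cong ⁇_ (ren-cancel ρ σ ρσ A)
ren-cancel ρ σ ρσ (! A)    = cong !_ (ren-cancel ρ σ ρσ A)

inst-zero-lift-suc : ∀ m → inst 0 (lift suc m) ≡ m
inst-zero-lift-suc zero    = refl
inst-zero-lift-suc (suc m) = refl

-- Instantiating the bound variable of the weakened body by the fresh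
-- variable 0 gives back the body: the instance used by ∀-elimination and
-- ∃-introduction under gen∀ / gen∃.
ren-lift-suc-[0] : ∀ {s} (A : Fm s) → ren (lift suc) A [ 0 ] ≡ A
ren-lift-suc-[0] = ren-cancel (inst 0) (lift suc) inst-zero-lift-suc

-- A derivation of G ⇒ A is read as a derivation of A in the context G,
-- with the context extended by conjunction.
module Hilbert (Ax : Principles) (Rl : Rules) (Hy : Principles) where

  infix 2 ⊢_

  ⊢_ : ∀ {s} → Fm s → Set
  ⊢_ = Der Ax Rl Hy

  const : ∀ {s} {A B : Fm s} → ⊢ B → ⊢ A ⇒ B
  const = mp (ax (k _ _))

  apply : ∀ {s} {G A B : Fm s} → ⊢ G ⇒ A ⇒ B → ⊢ G ⇒ A → ⊢ G ⇒ B
  apply f x = mp (mp (ax (sk _ _ _)) f) x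

  ⇒-trans : ∀ {s} {A B C : Fm s} → ⊢ A ⇒ B → ⊢ B ⇒ C → ⊢ A ⇒ C
  ⇒-trans f g = apply (const g) f

  ⇒-refl : ∀ {s} {A : Fm s} → ⊢ A ⇒ A
  ⇒-refl {A = A} = apply (ax (k A (A ⇒ A))) (ax (k A A))

  closed : ∀ {s} {A : Fm s} → ⊢ ⊤' ⇒ A → ⊢ A
  closed der = mp der (ax ⊤i)

  ∧-intro : ∀ {s} {A B : Fm s} → ⊢ A → ⊢ B → ⊢ A ∧' B
  ∧-intro a b = mp (mp (ax (∧i _ _)) a) b

  ∧-fst : ∀ {s} {A B : Fm s} → ⊢ A ∧' B → ⊢ A
  ∧-fst = mp (ax (∧e₁ _ _))

  ∧-snd : ∀ {s} {A B : Fm s} → ⊢ A ∧' B → ⊢ B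
  ∧-snd = mp (ax (∧e₂ _ _))

  var : ∀ {s} {G A : Fm s} → ⊢ G ∧' A ⇒ A
  var = ax (∧e₂ _ _)

  weaken : ∀ {s} {G A B : Fm s} → ⊢ G ⇒ B → ⊢ G ∧' A ⇒ B
  weaken = ⇒-trans (ax (∧e₁ _ _))

  curry : ∀ {s} {G A B : Fm s} → ⊢ G ∧' A ⇒ B → ⊢ G ⇒ A ⇒ B
  curry f = apply (apply (const compose) (const f)) (ax (∧i _ _))
    where
    compose : ∀ {X Y Z : Fm _} → ⊢ (Y ⇒ Z) ⇒ (X ⇒ Y) ⇒ X ⇒ Z
    compose = ⇒-trans (ax (k _ _)) (ax (sk _ _ _))

  uncurry : ∀ {s} {G A B : Fm s} → ⊢ G ⇒ A ⇒ B → ⊢ G ∧' A ⇒ B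
  uncurry f = apply (weaken f) var

  inl : ∀ {s} {G A B : Fm s} → ⊢ G ⇒ A → ⊢ G ⇒ A ∨' B
  inl der = ⇒-trans der (ax (∨i₁ _ _))

  inr : ∀ {s} {G A B : Fm s} → ⊢ G ⇒ B → ⊢ G ⇒ A ∨' B
  inr der = ⇒-trans der (ax (∨i₂ _ _))

  case : ∀ {s} {G A B C : Fm s} → ⊢ G ⇒ A ∨' B → ⊢ G ∧' A ⇒ C → ⊢ G ∧' B ⇒ C → ⊢ G ⇒ C
  case der f g = apply (apply (apply (const (ax (∨e _ _ _))) (curry f)) (curry g)) der

  ∨-map : ∀ {s} {A B C E : Fm s} → ⊢ A ⇒ C → ⊢ B ⇒ E → ⊢ A ∨' B ⇒ C ∨' E
  ∨-map f g = case ⇒-refl (inl (⇒-trans var f)) (inr (⇒-trans var g))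

  ∨-comm : ∀ {s} {A B : Fm s} → ⊢ A ∨' B ⇒ B ∨' A
  ∨-comm = case ⇒-refl (inr var) (inl var)

  absurd : ∀ {s} {G C : Fm s} → ⊢ G ⇒ ⊥' → ⊢ G ⇒ C
  absurd der = ⇒-trans der (ax (⊥e _))

  contraposition : ∀ {s} {A B : Fm s} → ⊢ A ⇒ B → ⊢ ~ B ⇒ ~ A
  contraposition f = curry (apply (weaken ⇒-refl) (⇒-trans var f))

  ¬¬-intro : ∀ {s} {A : Fm s} → ⊢ A ⇒ ~ ~ A
  ¬¬-intro = curry (apply var (weaken ⇒-refl))

  ¬¬-map : ∀ {s} {A B : Fm s} → ⊢ A ⇒ B → ⊢ ~ ~ A ⇒ ~ ~ B
  ¬¬-map f = contraposition (contraposition f)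

  non-contradiction : ∀ {s} {A : Fm s} → ⊢ ~ (A ∧' ~ A)
  non-contradiction = closed (curry (apply (⇒-trans var (ax (∧e₂ _ _))) (⇒-trans var (ax (∧e₁ _ _)))))

  ¬¬∨-resolve : ∀ {s} {A B : Fm s} → ⊢ ~ A ⇒ ~ ~ (A ∨' B) ⇒ ~ ~ B
  ¬¬∨-resolve = closed (curry (curry (curry (apply (weaken var) (curry
    (case var (apply (weaken (weaken (weaken (weaken var)))) var)
              (apply (weaken (weaken var)) var)))))))

  ∀-elim₀ : ∀ {s} {A : Fm s} → ⊢ wk (∀' A) ⇒ A
  ∀-elim₀ {A = A} = subst (λ X → ⊢ wk (∀' A) ⇒ X) (ren-lift-suc-[0] A) (ax (∀e _ 0))

  ∃-intro₀ : ∀ {s} {A : Fm s} → ⊢ A ⇒ wk (∃' A)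
  ∃-intro₀ {A = A} = subst (λ X → ⊢ X ⇒ wk (∃' A)) (ren-lift-suc-[0] A) (ax (∃i _ 0))

  ∀-map : ∀ {s} {A B : Fm s} → ⊢ A ⇒ B → ⊢ ∀' A ⇒ ∀' B
  ∀-map f = gen∀ (⇒-trans ∀-elim₀ f)

  ∃-map : ∀ {s} {A B : Fm s} → ⊢ A ⇒ B → ⊢ ∃' A ⇒ ∃' B
  ∃-map f = gen∃ (⇒-trans f ∃-intro₀)

  !-map : {p q : Fm c} → ⊢ p ⇒ q → ⊢ ! p ⇒ ! q
  !-map der = mp (ax (!⇒ _ _)) (bang der)

  ?-map : {α β : Fm i} → ⊢ α ⇒ β → ⊢ ⁇ α ⇒ ⁇ β
  ?-map der = mp (ax (?⇒ _ _)) (unbang (mp (ax (γ!? _)) der))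

  ⇒∇ : {α : Fm i} → ⊢ α ⇒ ∇ α
  ⇒∇ = ax (γ!? _)

  ?¬⇒¬? : {α : Fm i} → ⊢ ⁇ (~ α) ⇒ ~ ⁇ α
  ?¬⇒¬? = curry (⇒-trans (uncurry (ax (?⇒ _ _))) (ax ¬?⊥))

  ∇¬⇒¬∇ : {α : Fm i} → ⊢ ∇ (~ α) ⇒ ~ ∇ α
  ∇¬⇒¬∇ = curry (⇒-trans (uncurry (⇒-trans (!-map ?¬⇒¬?) (ax (!⇒ _ _)))) (ax ¬!⊥))

  ∇⇒¬¬ : {α : Fm i} → ⊢ ∇ α ⇒ ~ ~ α
  ∇⇒¬¬ = curry (apply (⇒-trans var (⇒-trans ⇒∇ ∇¬⇒¬∇)) (weaken ⇒-refl))

  ∇¬⇒¬ : {α : Fm i} → ⊢ ∇ (~ α) ⇒ ~ α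
  ∇¬⇒¬ = curry (apply (weaken ∇¬⇒¬∇) (⇒-trans var ⇒∇))

  ¬∇⇒!¬? : {α : Fm i} → ⊢ ~ ∇ α ⇒ ! (~ ⁇ α)
  ¬∇⇒!¬? = ⇒-trans ⇒∇ (!-map (curry (⇒-trans (∧-snd (ax (?∧ _ _))) (⇒-trans (?-map refute) (ax ¬?⊥)))))
    where
    refute : ∀ {γ} → ⊢ ~ ∇ γ ∧' γ ⇒ ⊥'
    refute = apply (ax (∧e₁ _ _)) (⇒-trans var ⇒∇)

  module WithH (h-principle : (γ : Fm i) → ⊢ ⁇ (γ ∨' ~ γ)) where

    ¬¬⇒∇ : {α : Fm i} → ⊢ ~ ~ α ⇒ ∇ α
    ¬¬⇒∇ {α} = ⇒-trans (contraposition ∇¬⇒¬) (⇒-trans ¬∇⇒!¬? (!-map ¬?¬⇒?))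
      where
      ¬?¬⇒? : ⊢ ~ ⁇ (~ α) ⇒ ⁇ α
      ¬?¬⇒? = case (const (mp (∧-fst (ax (?∨ _ _))) (h-principle α))) var (absurd (apply (weaken ⇒-refl) var))

    ∇∨-split : {α β : Fm i} → ⊢ ~ α ∨' ∇ α → ⊢ ∇ (α ∨' β) ⇒ ∇ α ∨' ∇ β
    ∇∨-split dichotomy =
      case (const dichotomy)
           (inr (⇒-trans (apply (apply (const ¬¬∨-resolve) var) (weaken ∇⇒¬¬)) ¬¬⇒∇))
           (inl var)

    ∇-lem : (α : Fm i) → ⊢ ∇ (α ∨' ~ α)
    ∇-lem α = bang (h-principle α)

    lem⇒pc : {α : Fm i} → ⊢ α ∨' ~ α → ⊢ ∇ α ⇒ α
    lem⇒pc l = case (const l) var (absurd (apply (weaken ∇⇒¬¬) var))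

module Extension (P : Principles) where
  open Hilbert (H ∪ P) NoRules NoHyps public
  open WithH (λ γ → ext (inj₁ (h γ))) public

  principle : ∀ {s} {F : Fm s} → P F → ⊢ F
  principle p = ext (inj₂ p)

pc⊩pc-rule : PC⊩PCRule
pc⊩pc-rule α = mp (ext (inj₂ (pc α))) (hyp here)

pc-rule⊩pc : PCRule⊩PC
pc-rule⊩pc (pc α) = lem⇒pc (extR (pcr (α ∨' ~ α)) (∇-lem α))
  where
  open Hilbert H PCRule NoHyps
  open WithH (λ γ → ext (h γ))

pc⊩lem : PC ⊩ LEM
pc⊩lem (lem α) = mp (principle (pc (α ∨' ~ α))) (∇-lem α)
  where open Extension PC

lem⊩pc : LEM ⊩ PC
lem⊩pc (pc α) = lem⇒pc (principle (lem α))
  where open Extension LEM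

d⊩jankov : D ⊩ Jankov
d⊩jankov (jan α) = mp (∨-map ∇¬⇒¬ ∇¬⇒¬) (mp (principle (d (~ α) (~ ~ α))) (∇-lem (~ α)))
  where open Extension D

jankov⊩d : Jankov ⊩ D
jankov⊩d (d α β) = ∇∨-split (mp (∨-map ⇒-refl ¬¬⇒∇) (principle (jan α)))
  where open Extension Jankov

∀∇⊩dns : ∀∇ ⊩ DNS
∀∇⊩dns (dns α) = ⇒-trans (∀-map ¬¬⇒∇) (⇒-trans (∧-snd (principle (a∇ α))) ∇⇒¬¬)
  where open Extension ∀∇

dns⊩∀∇ : DNS ⊩ ∀∇
dns⊩∀∇ (a∇ α) = ∧-intro (⇒-trans ∇⇒¬¬ (⇒-trans (gen∀ (¬¬-map ∀-elim₀)) (∀-map ¬¬⇒∇)))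
                        (⇒-trans (∀-map ∇⇒¬¬) (⇒-trans (principle (dns α)) ¬¬⇒∇))
  where open Extension DNS

∃∇⊩smp : ∃∇ ⊩ SMP
∃∇⊩smp (smp α) = ⇒-trans ¬¬⇒∇ (⇒-trans (∧-snd (principle (e∇ α))) (∃-map ∇⇒¬¬))
  where open Extension ∃∇

smp⊩∃∇ : SMP ⊩ ∃∇
smp⊩∃∇ (e∇ α) = ∧-intro (⇒-trans (∃-map ∇⇒¬¬) (⇒-trans (gen∃ (¬¬-map ∃-intro₀)) ¬¬⇒∇))
                        (⇒-trans ∇⇒¬¬ (⇒-trans (principle (smp α)) (∃-map ¬¬⇒∇)))
  where open Extension SMP

ed⊩wlem∇ : ED ⊩ WLEM∇
ed⊩wlem∇ (wl α) = mp (∨-map ⇒-refl (⇒-trans ∇¬⇒¬ (⇒-trans ¬¬-intro (contraposition ∇⇒¬¬))))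
                     (mp (mp (principle (ed α (~ α))) non-contradiction) (∇-lem α))
  where open Extension ED

wlem∇⊩ed : WLEM∇ ⊩ ED
wlem∇⊩ed (ed α β) = const (∇∨-split (mp (∨-map (contraposition ⇒∇) ⇒-refl) (mp ∨-comm (principle (wl α)))))
  where open Extension WLEM∇

mainTheorem18 : (PC⊩PCRule × PCRule⊩PC × (PC ≣ LEM))
    × (D ≣ Jankov)
    × (∀∇ ≣ DNS)
    × (∃∇ ≣ SMP)
    × (ED ≣ WLEM∇)
mainTheorem18 = (pc⊩pc-rule , pc-rule⊩pc , (pc⊩lem , lem⊩pc))
  , (d⊩jankov , jankov⊩d) , (∀∇⊩dns , dns⊩∀∇) , (∃∇⊩smp , smp⊩∃∇) , (ed⊩wlem∇ , wlem∇⊩ed)
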